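{- Let \(\mathcal V\) be a universe. If every \(\mathcal V\)-covered subset (of any type, with values in any universe) has a \(\mathcal V\)-small total space, then for every universe \(\mathcal U\), every proposition \(P:\mathcal U\) is \(\mathcal V\)-small.
   Context: Work in univalent foundations (intensional Martin-Löf type theory with universes, function and propositional extensionality, propositional truncations). A type is \(\mathcal V\)-small if equivalent to a type in \(\mathcal V\). \(\Omega_{\mathcal T}\) is the type of propositions in \(\mathcal T\). A subset of a type \(X\) is a map \(S:X\to\Omega_{\mathcal T}\); its total space is \(\mathbb T(S):=\Sigma_{x:X}(x\in S)\). \(S\) is \(\mathcal V\)-covered if there is a type \(I:\mathcal V\) with a surjection \(e:I\to\mathbb T(S)\) (every element of \(\mathbb T(S)\) merely has a preimage). -}

module Defs where

open import Level using (Level; _⊔_; suc; Setω)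
open import Data.Product using (Σ; _,_; proj₁; proj₂)
open import Relation.Binary.PropositionalEquality using (_≡_)
open import Function.Bundles using (_↔_)
open import Axiom.Extensionality.Propositional using (Extensionality)

isProp : ∀ {ℓ} → Set ℓ → Set ℓ
isProp A = (x y : A) → x ≡ y

Ω : (t : Level) → Set (suc t)
Ω t = Σ (Set t) isProp

record PropTrunc : Setω where
  field
    ∥_∥ : ∀ {ℓ} → Set ℓ → Set ℓ
    ∥∥-isProp : ∀ {ℓ} {A : Set ℓ} → isProp ∥ A ∥
    ∣_∣ : ∀ {ℓ} {A : Set ℓ} → A → ∥ A ∥
    ∥∥-rec : ∀ {ℓ ℓ'} {A : Set ℓ} {B : Set ℓ'} → isProp B → (A → B) → ∥ A ∥ → B

FunExt : Setω
FunExt = ∀ {a b} → Extensionality a b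

PropExt : Setω
PropExt = ∀ {ℓ} {P Q : Set ℓ} → isProp P → isProp Q → (P → Q) → (Q → P) → P ≡ Q

is-small : ∀ {u} (v : Level) → Set u → Set (u ⊔ suc v)
is-small v X = Σ (Set v) (λ Y → Y ↔ X)

module _ (pt : PropTrunc) where
  open PropTrunc pt

  _∈_ : ∀ {u t} {X : Set u} → X → (X → Ω t) → Set t
  x ∈ S = proj₁ (S x)

  𝕋 : ∀ {u t} {X : Set u} → (X → Ω t) → Set (u ⊔ t)
  𝕋 {X = X} S = Σ X (λ x → x ∈ S)

  is-surjection : ∀ {a b} {A : Set a} {B : Set b} → (A → B) → Set (a ⊔ b)
  is-surjection {A = A} e = ∀ y → ∥ Σ A (λ i → e i ≡ y) ∥

  is-covered : ∀ {u t} (v : Level) {X : Set u} → (X → Ω t) → Set (u ⊔ t ⊔ suc v)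
  is-covered v S = Σ (Set v) (λ I → Σ (I → 𝕋 S) is-surjection)

{-# OPTIONS --safe #-}
-- The two-point subset {P, 𝟙} of the universe is covered by Bool, so by hypothesis
-- its total space is 𝒱-small. Truncated identity types of a small type are small,
-- and by propositional extensionality P is logically equivalent to the proposition
-- ∥ (P , _) ≡ (𝟙 , _) ∥ in that total space.
module Submission where

open import Defs
open import Level using (Level; Lift; lift) renaming (suc to lsuc)
open import Data.Unit using (⊤; tt)
open import Data.Bool using (Bool; true; false)
open import Data.Sum using (_⊎_; inj₁; inj₂)
open import Data.Product using (Σ; _,_; proj₁; proj₂)
open import Function using (id; _∘_)
open import Function.Bundles using (_↔_; mk↔ₛ′; Inverse)
open import Relation.Binary.PropositionalEquality
  using (_≡_; refl; sym; trans; cong; subst)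
open import Relation.Binary.PropositionalEquality.Properties using (module ≡-Reasoning)

private
  variable
    a b v : Level
    A : Set a
    B : Set b

⊤-isProp : isProp (Lift a ⊤)
⊤-isProp _ _ = refl

inhabited-prop-≡-⊤ : PropExt → isProp A → A → A ≡ Lift a ⊤
inhabited-prop-≡-⊤ pe A-prop x = pe A-prop ⊤-isProp (λ _ → lift tt) (λ _ → x)

≡-⊤⇒inhabited : A ≡ Lift a ⊤ → A
≡-⊤⇒inhabited eq = subst id (sym eq) (lift tt)

↔-preserves-isProp : A ↔ B → isProp B → isProp A
↔-preserves-isProp A↔B B-prop x y = begin
  x                ≡⟨ sym (strictlyInverseʳ x) ⟩
  from (to x)      ≡⟨ cong from (B-prop (to x) (to y)) ⟩
  from (to y)      ≡⟨ strictlyInverseʳ y ⟩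
  y                ∎
  where open Inverse A↔B
        open ≡-Reasoning

is-small-⇔ : isProp A → isProp B → (A → B) → (B → A) → is-small v A → is-small v B
is-small-⇔ A-prop B-prop f g (Y , Y↔A) =
  Y , mk↔ₛ′ (f ∘ to) (from ∘ g)
            (λ _ → B-prop _ _)
            (λ _ → ↔-preserves-isProp Y↔A A-prop _ _)
  where open Inverse Y↔A

module _ (pt : PropTrunc) where
  open PropTrunc pt

  is-small-∥≡∥ : {X : Set a} → is-small v X → (x y : X) → is-small v ∥ x ≡ y ∥
  is-small-∥≡∥ (Y , Y↔X) x y =
    ∥ from x ≡ from y ∥ ,
    mk↔ₛ′ (∥∥-rec ∥∥-isProp (λ p → ∣ from-injective p ∣))
          (∥∥-rec ∥∥-isProp (λ p → ∣ cong from p ∣))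
          (λ _ → ∥∥-isProp _ _)
          (λ _ → ∥∥-isProp _ _)
    where
    open Inverse Y↔X
    from-injective : ∀ {x y} → from x ≡ from y → x ≡ y
    from-injective {x} {y} p =
      trans (sym (strictlyInverseˡ x)) (trans (cong to p) (strictlyInverseˡ y))

  𝕋-≡ : ∀ {t} {X : Set a} (S : X → Ω t) {x y : X} (p : _∈_ pt x S) (q : _∈_ pt y S)
      → x ≡ y → _≡_ {A = 𝕋 pt S} (x , p) (y , q)
  𝕋-≡ S {x} p q refl = cong (x ,_) (proj₂ (S x) p q)

  pair : {X : Set a} → X → X → X → Ω a
  pair x y z = ∥ (z ≡ x) ⊎ (z ≡ y) ∥ , ∥∥-isProp

  pair-is-covered : {X : Set a} (x y : X) → is-covered pt v (pair x y)
  pair-is-covered {v = v} x y = Lift v Bool , choose , choose-is-surjection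
    where
    choose : Lift v Bool → 𝕋 pt (pair x y)
    choose (lift false) = x , ∣ inj₁ refl ∣
    choose (lift true)  = y , ∣ inj₂ refl ∣
    choose-is-surjection : is-surjection pt choose
    choose-is-surjection (z , z∈pair) = ∥∥-rec ∥∥-isProp hit z∈pair
      where
      hit : (z ≡ x) ⊎ (z ≡ y) → ∥ Σ (Lift v Bool) (λ i → choose i ≡ (z , z∈pair)) ∥
      hit (inj₁ refl) = ∣ lift false , 𝕋-≡ (pair x y) _ _ refl ∣
      hit (inj₂ refl) = ∣ lift true  , 𝕋-≡ (pair x y) _ _ refl ∣

proposition6p6 : (pt : PropTrunc) → FunExt → PropExt → (v : Level)
    → (∀ {u t} (X : Set u) (S : X → Ω t) → is-covered pt v S → is-small v (𝕋 pt S))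
    → ∀ {u} (P : Set u) → isProp P → is-small v P
proposition6p6 pt _ pe v covered-is-small {u} P P-prop =
  is-small-⇔ ∥∥-isProp P-prop
    (∥∥-rec P-prop (λ eq → ≡-⊤⇒inhabited (cong proj₁ eq)))
    (λ p → ∣ 𝕋-≡ pt S _ _ (inhabited-prop-≡-⊤ pe P-prop p) ∣)
    (is-small-∥≡∥ pt (covered-is-small (Set u) S (pair-is-covered pt P 𝟙)) [P] [𝟙])
  where
  open PropTrunc pt
  𝟙 : Set u
  𝟙 = Lift u ⊤
  S : Set u → Ω (lsuc u)
  S = pair pt P 𝟙
  [P] [𝟙] : 𝕋 pt S
  [P] = P , ∣ inj₁ refl ∣
  [𝟙] = 𝟙 , ∣ inj₂ refl ∣
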